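{- Let $m,n$ be positive integers. Every row $L_i=\{(i,j):1\le j\le n\}$ ($1\le i\le m$) and every column $C_j=\{(i,j):1\le i\le m\}$ ($1\le j\le n$) of the grid $G_{m,n}$ is a co-convex set.
   Context: $G_{m,n}$ has vertex set $\{(i,j):1\le i\le m,1\le j\le n\}$ with $(i,j)$ adjacent to $(i,j+1)$ and to $(i+1,j)$ whenever these exist. A cycle is a closed walk $(v_1,\dots,v_q,v_1)$ with at least one edge in which the only repeated vertex is $v_1$. For $S\subseteq V(G)$, $I_{cc}(S)=S\cup\{v\in V(G): \text{there is a cycle } C \text{ of } G \text{ with } V(C)\setminus S=\{v\}\}$. A set $X$ is convex if $I_{cc}(X)=X$, and co-convex if $V(G)\setminus X$ is convex. -}

module Defs where

open import Data.Nat using (ℕ; suc; _≤_; _<_)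
open import Data.Nat.Properties using ()
open import Data.Fin using (Fin; toℕ)
open import Data.Product using (_×_; _,_; Σ; ∃; proj₁; proj₂)
open import Data.Sum using (_⊎_)
open import Data.Empty using (⊥)
open import Data.List using (List; []; _∷_; length)
open import Data.List.Membership.Propositional using (_∈_)
open import Data.List.Relation.Unary.Unique.Propositional using (Unique)
open import Relation.Binary.PropositionalEquality using (_≡_)
open import Relation.Nullary using (¬_)

-- Vertices of G_{m,n}: (i , j) with i ∈ Fin m, j ∈ Fin n  (0-indexed; (i,j) ↔ (i+1,j+1)).
Vertex : ℕ → ℕ → Set
Vertex m n = Fin m × Fin n

Adj : ∀ {m n} → Vertex m n → Vertex m n → Set
Adj (i , j) (i' , j') =
    (i ≡ i' × (suc (toℕ j) ≡ toℕ j' ⊎ suc (toℕ j') ≡ toℕ j))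
  ⊎ (j ≡ j' × (suc (toℕ i) ≡ toℕ i' ⊎ suc (toℕ i') ≡ toℕ i))

VSet : ℕ → ℕ → Set₁
VSet m n = Vertex m n → Set

ClosesPath : ∀ {m n} → Vertex m n → List (Vertex m n) → Set
ClosesPath first []            = ⊥
ClosesPath first (v ∷ [])      = Adj v first
ClosesPath first (v ∷ w ∷ vs)  = Adj v w × ClosesPath first (w ∷ vs)

-- A cycle (v₁,…,v_q,v₁): the list [v₁,…,v_q] of pairwise distinct vertices,
-- consecutive ones adjacent, v_q adjacent to v₁, and q ≥ 3 (a graph cycle).
IsCycle : ∀ {m n} → List (Vertex m n) → Set
IsCycle [] = ⊥
IsCycle (v ∷ vs) = Unique (v ∷ vs) × 3 ≤ length (v ∷ vs) × ClosesPath v (v ∷ vs)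

Icc : ∀ {m n} → VSet m n → VSet m n
Icc {m} {n} S v =
  S v ⊎ Σ (List (Vertex m n)) λ C →
    IsCycle C × v ∈ C × ¬ S v × (∀ w → w ∈ C → ¬ S w → w ≡ v)

_⊆_ : ∀ {m n} → VSet m n → VSet m n → Set
X ⊆ Y = ∀ v → X v → Y v

Convex : ∀ {m n} → VSet m n → Set
Convex X = Icc X ⊆ X × X ⊆ Icc X

Complement : ∀ {m n} → VSet m n → VSet m n
Complement X v = ¬ X v

CoConvex : ∀ {m n} → VSet m n → Set
CoConvex X = Convex (Complement X)

Row : ∀ {m n} → Fin m → VSet m n
Row i (i' , j') = i' ≡ i

Column : ∀ {m n} → Fin n → VSet m n
Column j (i' , j') = j' ≡ j

-- A row (column) is a level set of the height function "row index" ("column index"),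
-- which changes by at most one along an edge. If a cycle met the level of v only in v,
-- the rest of the cycle would be a walk between the two cycle-neighbours b and c of v
-- that never touches the level, so b and c lie on the same side of it and thus both at
-- height h v + 1 or both at h v - 1. But a vertex has at most one neighbour at any height
-- other than its own (the one in its column, resp. row), so b = c, contradicting that
-- the vertices of a cycle are distinct and at least three.

module Submission where

open import Defs

open import Data.Nat using (ℕ; suc; _≤_; _<_; s≤s; s≤s⁻¹)
open import Data.Nat.Properties
  using (≤-reflexive; ≤-trans; ≤-antisym; n≤1+n; m<n⇒m≤1+n; ≤∧≢⇒<; <-cmp; suc-injective)
open import Data.Fin using (Fin; toℕ)
open import Data.Fin.Properties using (toℕ-injective)
open import Data.Product using (_×_; _,_; Σ; proj₁; proj₂; map₁)
open import Data.Sum using (inj₁; inj₂)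
open import Data.Empty using (⊥; ⊥-elim)
open import Data.List using (List; []; _∷_; _++_; _∷ʳ_; initLast; _∷ʳ′_)
open import Data.List.Relation.Unary.All using (All; []; _∷_; tabulate)
import Data.List.Relation.Unary.All as All
open import Data.List.Relation.Unary.All.Properties using (∷ʳ⁻)
open import Data.List.Relation.Unary.AllPairs as AllPairs using (_∷_)
open import Data.List.Relation.Unary.Linked as Linked using (Linked; [-]; _∷_)
open import Data.List.Relation.Unary.Any using (there)
open import Data.List.Membership.Propositional using (_∈_)
open import Data.List.Membership.Propositional.Properties using (∈-∃++)
open import Data.List.Relation.Binary.Permutation.Propositional using (_↭_; ↭-refl; ↭-sym; ↭⇒↭ₛ)
open import Data.List.Relation.Binary.Permutation.Propositional.Properties using (++-comm; ∈-resp-↭; ↭-length)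
open import Data.List.Relation.Binary.Permutation.Setoid.Properties using (Unique-resp-↭)
open import Relation.Binary.PropositionalEquality using (_≡_; _≢_; ≢-sym; refl; sym; trans; cong; subst; setoid)
open import Relation.Binary using (Rel; tri<; tri≈; tri>)
open import Relation.Nullary using (¬_)
open import Relation.Unary using (Pred)

module _ {a r p q} {A : Set a} {R : Rel A r} {P : Pred A p} {Q : Pred A q} where

  Linked-propagate : (∀ {x y} → R x y → Q y → P x → P y) →
                     ∀ {x xs} → Linked R (x ∷ xs) → All Q xs → P x → All P (x ∷ xs)
  Linked-propagate step [-]     []       px = px ∷ []
  Linked-propagate step (r ∷ l) (qy ∷ qs) px = px ∷ Linked-propagate step l qs (step r qy px)

module _ {m n : ℕ} where

  private
    V : Set
    V = Vertex m n

  Adj-sym : ∀ {a b : V} → Adj a b → Adj b a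
  Adj-sym (inj₁ (refl , inj₁ e)) = inj₁ (refl , inj₂ e)
  Adj-sym (inj₁ (refl , inj₂ e)) = inj₁ (refl , inj₁ e)
  Adj-sym (inj₂ (refl , inj₁ e)) = inj₂ (refl , inj₂ e)
  Adj-sym (inj₂ (refl , inj₂ e)) = inj₂ (refl , inj₁ e)

  closesPath⇒linked : ∀ {f x : V} xs → ClosesPath f (x ∷ xs) → Linked Adj (x ∷ xs ∷ʳ f)
  closesPath⇒linked []       e       = e ∷ [-]
  closesPath⇒linked (_ ∷ xs) (e , c) = e ∷ closesPath⇒linked xs c

  linked⇒closesPath : ∀ {f x : V} xs → Linked Adj (x ∷ xs ∷ʳ f) → ClosesPath f (x ∷ xs)
  linked⇒closesPath []       (e ∷ [-]) = e
  linked⇒closesPath (_ ∷ xs) (e ∷ l)   = e , linked⇒closesPath xs l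

  closesPath-split : ∀ {f x v : V} {ys} xs → ClosesPath f (x ∷ xs ++ v ∷ ys) →
                     Linked Adj (x ∷ xs ∷ʳ v) × Linked Adj (v ∷ ys ∷ʳ f)
  closesPath-split []       (e , c) = e ∷ [-] , closesPath⇒linked _ c
  closesPath-split (_ ∷ xs) (e , c) = map₁ (e ∷_) (closesPath-split xs c)

  closesPath-join : ∀ {f x v : V} {xs} ys →
                    Linked Adj (v ∷ ys ∷ʳ x) → Linked Adj (x ∷ xs ∷ʳ f) → ClosesPath f (v ∷ ys ++ x ∷ xs)
  closesPath-join []       (e ∷ [-]) l = e , linked⇒closesPath _ l
  closesPath-join (_ ∷ ys) (e ∷ l₁)  l = e , closesPath-join ys l₁ l

  closesPath-rotate : ∀ {x v : V} xs ys →
                      ClosesPath x (x ∷ xs ++ v ∷ ys) → ClosesPath v (v ∷ ys ++ x ∷ xs)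
  closesPath-rotate xs ys c = let l₁ , l₂ = closesPath-split xs c in closesPath-join ys l₂ l₁

  cycle-rotate : ∀ {C} {v : V} → IsCycle C → v ∈ C →
                 Σ (List V) λ p → IsCycle (v ∷ p) × C ↭ v ∷ p
  cycle-rotate {c ∷ cs} {v} cyc@(unique , long , closed) v∈C with ∈-∃++ v∈C
  ... | []     , ys , refl = cs , cyc , ↭-refl
  ... | x ∷ xs , ys , refl =
    ys ++ x ∷ xs
    , ( Unique-resp-↭ (setoid V) (↭⇒↭ₛ σ) unique
      , subst (3 ≤_) (↭-length σ) long
      , closesPath-rotate xs ys closed )
    , σ
    where
    σ : x ∷ xs ++ v ∷ ys ↭ v ∷ ys ++ x ∷ xs
    σ = ++-comm (x ∷ xs) (v ∷ ys)

coConvex-if-no-cycle-meets-once : ∀ {m n} {S : VSet m n} →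
  (∀ {C v} → IsCycle C → v ∈ C → S v → (∀ w → w ∈ C → S w → w ≡ v) → ⊥) → CoConvex S
coConvex-if-no-cycle-meets-once {S = S} never = closed , (λ _ → inj₁)
  where
  closed : ∀ v → Icc (Complement S) v → ¬ S v
  closed v (inj₁ v∉S)                             = v∉S
  closed v (inj₂ (C , cyc , v∈C , _ , only)) v∈S =
    never cyc v∈C v∈S (λ w w∈C w∈S → only w w∈C (λ w∉S → w∉S w∈S))

module LevelSets {m n l : ℕ} (coord : Vertex m n → Fin l)
  (adj-≤ : ∀ {a b} → Adj a b → toℕ (coord b) ≤ suc (toℕ (coord a)))
  (adj-off-level-unique : ∀ {a c v} → Adj a v → Adj c v →
    toℕ (coord a) ≡ toℕ (coord c) → toℕ (coord a) ≢ toℕ (coord v) → a ≡ c)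
  where

  private
    V : Set
    V = Vertex m n

  height : V → ℕ
  height w = toℕ (coord w)

  below-step : ∀ {k} {x y : V} → Adj x y → height y ≢ k → height x < k → height y < k
  below-step adj y≢k x<k = ≤∧≢⇒< (≤-trans (adj-≤ adj) x<k) y≢k

  above-step : ∀ {k} {x y : V} → Adj x y → height y ≢ k → k < height x → k < height y
  above-step adj y≢k k<x = ≤∧≢⇒< (s≤s⁻¹ (≤-trans k<x (adj-≤ (Adj-sym adj)))) (≢-sym y≢k)

  below-neighbour : ∀ {b v : V} → Adj b v → height b < height v → suc (height b) ≡ height v
  below-neighbour adj b<v = ≤-antisym b<v (adj-≤ adj)

  above-neighbour : ∀ {b v : V} → Adj v b → height v < height b → height b ≡ suc (height v)
  above-neighbour adj v<b = ≤-antisym (adj-≤ adj) v<b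

  detour-ends-same-height : ∀ {v b c : V} zs → Adj v b → Adj c v → Linked Adj (b ∷ zs ∷ʳ c) →
                            All (λ w → height w ≢ height v) (b ∷ zs ∷ʳ c) →
                            height b ≡ height c
  detour-ends-same-height {v} {b} {c} zs vb cv path (b≢v ∷ off′) with <-cmp (height b) (height v)
  ... | tri< b<v _ _ =
    suc-injective (trans (below-neighbour (Adj-sym vb) b<v) (sym (below-neighbour cv c<v)))
    where
    c<v : height c < height v
    c<v = proj₂ (∷ʳ⁻ {xs = b ∷ zs} (Linked-propagate below-step path off′ b<v))
  ... | tri≈ _ b≡v _ = ⊥-elim (b≢v b≡v)
  ... | tri> _ _ v<b =
    trans (above-neighbour vb v<b) (sym (above-neighbour (Adj-sym cv) v<c))
    where
    v<c : height v < height c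
    v<c = proj₂ (∷ʳ⁻ {xs = b ∷ zs} (Linked-propagate above-step path off′ v<b))

  cycle-revisits-level : ∀ {v : V} {p} → IsCycle (v ∷ p) → ¬ All (λ w → height w ≢ height v) p
  cycle-revisits-level {p = []}    (_ , s≤s () , _)
  cycle-revisits-level {p = b ∷ q} _ _ with initLast q
  cycle-revisits-level {p = b ∷ _} (_ , s≤s (s≤s ()) , _) _ | []
  cycle-revisits-level {v} {b ∷ _} (_ ∷ (b∉ ∷ _) , _ , vb , closed) off | zs ∷ʳ′ c =
    proj₂ (∷ʳ⁻ b∉)
      (adj-off-level-unique (Adj-sym vb) cv (detour-ends-same-height zs vb cv path off) (All.head off))
    where
    path : Linked Adj (b ∷ zs ∷ʳ c)
    path = proj₁ (closesPath-split zs closed)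
    cv : Adj c v
    cv = Linked.head (proj₂ (closesPath-split zs closed))

  levelSet-coConvex : (a : Fin l) → CoConvex (λ w → coord w ≡ a)
  levelSet-coConvex a = coConvex-if-no-cycle-meets-once λ cyc v∈C v∈L only →
    let p , cyc′ , σ = cycle-rotate cyc v∈C in
    -- a vertex of p at the level of v would be v itself, which p does not contain
    cycle-revisits-level cyc′ (tabulate λ {w} w∈p hw≡hv →
      All.lookup (AllPairs.head (proj₁ cyc′)) w∈p
        (sym (only w (∈-resp-↭ (↭-sym σ) (there w∈p)) (toℕ-injective (trans hw≡hv (cong toℕ v∈L))))))

row-adj-≤ : ∀ {m n} {a b : Vertex m n} → Adj a b → toℕ (proj₁ b) ≤ suc (toℕ (proj₁ a))
row-adj-≤ (inj₁ (refl , _))   = n≤1+n _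
row-adj-≤ (inj₂ (_ , inj₁ e)) = ≤-reflexive (sym e)
row-adj-≤ (inj₂ (_ , inj₂ e)) = m<n⇒m≤1+n (≤-reflexive e)

column-adj-≤ : ∀ {m n} {a b : Vertex m n} → Adj a b → toℕ (proj₂ b) ≤ suc (toℕ (proj₂ a))
column-adj-≤ (inj₂ (refl , _))   = n≤1+n _
column-adj-≤ (inj₁ (_ , inj₁ e)) = ≤-reflexive (sym e)
column-adj-≤ (inj₁ (_ , inj₂ e)) = m<n⇒m≤1+n (≤-reflexive e)

row-adj-off-level-unique : ∀ {m n} {a c v : Vertex m n} → Adj a v → Adj c v →
  toℕ (proj₁ a) ≡ toℕ (proj₁ c) → toℕ (proj₁ a) ≢ toℕ (proj₁ v) → a ≡ c
row-adj-off-level-unique (inj₁ (refl , _)) _                  _ a≢v = ⊥-elim (a≢v refl)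
row-adj-off-level-unique (inj₂ (refl , _)) (inj₁ (refl , _)) a≡c a≢v = ⊥-elim (a≢v a≡c)
row-adj-off-level-unique (inj₂ (refl , _)) (inj₂ (refl , _)) a≡c _
  rewrite toℕ-injective a≡c = refl

column-adj-off-level-unique : ∀ {m n} {a c v : Vertex m n} → Adj a v → Adj c v →
  toℕ (proj₂ a) ≡ toℕ (proj₂ c) → toℕ (proj₂ a) ≢ toℕ (proj₂ v) → a ≡ c
column-adj-off-level-unique (inj₂ (refl , _)) _                  _ a≢v = ⊥-elim (a≢v refl)
column-adj-off-level-unique (inj₁ (refl , _)) (inj₂ (refl , _)) a≡c a≢v = ⊥-elim (a≢v a≡c)
column-adj-off-level-unique (inj₁ (refl , _)) (inj₁ (refl , _)) a≡c _
  rewrite toℕ-injective a≡c = refl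

corollary4 : (m n : ℕ) →
    ((i : Fin (suc m)) → CoConvex {suc m} {suc n} (Row i))
    × ((j : Fin (suc n)) → CoConvex {suc m} {suc n} (Column j))
corollary4 m n = LevelSets.levelSet-coConvex proj₁ row-adj-≤ row-adj-off-level-unique
               , LevelSets.levelSet-coConvex proj₂ column-adj-≤ column-adj-off-level-unique
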